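{- The MTL formula $\mathsf{F}_{[1,1]}\mathrm{true}$ is not equivalent to any formula of $\mathrm{TPTL}_{=}$, the fragment of TPTL in which every constraint $x\in I$ has $I=[0,0]$.
   Context: Data words: infinite sequences $(P_0,d_0)(P_1,d_1)\dots$ with $P_i\subseteq\mathcal{P}$ (finite set of propositions) and $d_i\in\mathbb{N}$. Intervals are integer intervals with endpoints in $\mathbb{Z}\cup\{\pm\infty\}$. MTL: $\varphi::=p\mid\neg\varphi\mid\varphi_1\wedge\varphi_2\mid\varphi_1\mathsf{U}_I\varphi_2$; $(w,i)\models\varphi_1\mathsf{U}_I\varphi_2$ iff there is $j>i$ with $(w,j)\models\varphi_2$, $d_j-d_i\in I$, and $(w,k)\models\varphi_1$ for all $i<k<j$; $w\models\varphi$ iff $(w,0)\models\varphi$; $\mathrm{true}:=p\vee\neg p$ and $\mathsf{F}_I\varphi:=\mathrm{true}\,\mathsf{U}_I\,\varphi$. TPTL: $\varphi::=p\mid x\in I\mid\neg\varphi\mid\varphi_1\wedge\varphi_2\mid\varphi_1\mathsf{U}\varphi_2\mid x.\varphi$ with register variables; $(w,i,\nu)\models x\in I$ iff $d_i-\nu(x)\in I$; $(w,i,\nu)\models x.\varphi$ iff $(w,i,\nu[x\mapsto d_i])\models\varphi$; $(w,i,\nu)\models\varphi_1\mathsf{U}\varphi_2$ iff there is $j>i$ with $(w,j,\nu)\models\varphi_2$ and $(w,k,\nu)\models\varphi_1$ for all $i<k<j$; $w\models\varphi$ iff $(w,0,\nu_0)\models\varphi$ with $\nu_0$ mapping all registers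 to $d_0$. Equivalence: same set of satisfying data words. -}

module Defs where

open import Data.Nat using (ℕ; _>_; _<_)
open import Data.Integer as ℤ using (ℤ; +_; _-_)
open import Data.Fin using (Fin)
open import Data.Fin.Subset using (Subset; _∈_)
open import Data.Product using (Σ; _×_; ∃)
open import Data.Unit using (⊤)
open import Data.Empty using (⊥)
open import Relation.Nullary using (¬_)
open import Relation.Binary.PropositionalEquality using (_≡_)
open import Function.Bundles using (_⇔_)

record DataWord (n : ℕ) : Set where
  field
    props : ℕ → Subset n
    datum : ℕ → ℕ
open DataWord public

data Bound : Set where
  -∞ +∞ : Bound
  closed opn : ℤ → Bound

record Interval : Set where
  constructor ⟨_,_⟩
  field
    lo : Bound
    hi : Bound
open Interval public

aboveLo : Bound → ℤ → Set
aboveLo -∞ v = ⊤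
aboveLo +∞ v = ⊥
aboveLo (closed z) v = z ℤ.≤ v
aboveLo (opn z) v = z ℤ.< v

belowHi : Bound → ℤ → Set
belowHi -∞ v = ⊥
belowHi +∞ v = ⊤
belowHi (closed z) v = v ℤ.≤ z
belowHi (opn z) v = v ℤ.< z

_∈I_ : ℤ → Interval → Set
v ∈I I = aboveLo (lo I) v × belowHi (hi I) v

diff : ℕ → ℕ → ℤ
diff a b = (+ a) - (+ b)

data MTL (n : ℕ) : Set where
  prop : Fin n → MTL n
  ¬ᵐ_  : MTL n → MTL n
  _∧ᵐ_ : MTL n → MTL n → MTL n
  _Uᵐ[_]_ : MTL n → Interval → MTL n → MTL n

_⊨ᵐ_at_ : ∀ {n} → DataWord n → MTL n → ℕ → Set
w ⊨ᵐ prop p at i = p ∈ props w i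
w ⊨ᵐ (¬ᵐ φ) at i = ¬ (w ⊨ᵐ φ at i)
w ⊨ᵐ (φ ∧ᵐ ψ) at i = (w ⊨ᵐ φ at i) × (w ⊨ᵐ ψ at i)
w ⊨ᵐ (φ Uᵐ[ I ] ψ) at i =
  Σ ℕ λ j → (j > i) × (w ⊨ᵐ ψ at j) × (diff (datum w j) (datum w i) ∈I I)
          × (∀ k → i < k → k < j → w ⊨ᵐ φ at k)

_⊨ᵐ_ : ∀ {n} → DataWord n → MTL n → Set
w ⊨ᵐ φ = w ⊨ᵐ φ at 0

_∨ᵐ_ : ∀ {n} → MTL n → MTL n → MTL n
φ ∨ᵐ ψ = ¬ᵐ ((¬ᵐ φ) ∧ᵐ (¬ᵐ ψ))

trueᵐ : ∀ {n} → Fin n → MTL n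
trueᵐ p = prop p ∨ᵐ (¬ᵐ prop p)

Fᵐ[_]_ : ∀ {n} → Interval → Fin n → MTL n → MTL n
(Fᵐ[ I ] p) φ = trueᵐ p Uᵐ[ I ] φ

[_,_] : ℤ → ℤ → Interval
[ a , b ] = ⟨ closed a , closed b ⟩

F11true : ∀ {n} → Fin n → MTL n
F11true p = (Fᵐ[ [ + 1 , + 1 ] ] p) (trueᵐ p)

Reg : Set
Reg = ℕ

data TPTL (n : ℕ) : Set where
  prop  : Fin n → TPTL n
  _∈ᵗ_  : Reg → Interval → TPTL n
  ¬ᵗ_   : TPTL n → TPTL n
  _∧ᵗ_  : TPTL n → TPTL n → TPTL n
  _Uᵗ_  : TPTL n → TPTL n → TPTL n
  bind  : Reg → TPTL n → TPTL n

Valuation : Set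
Valuation = Reg → ℕ

update : Valuation → Reg → ℕ → Valuation
update ν x d y with y Data.Nat.≟ x
... | Relation.Nullary.yes _ = d
... | Relation.Nullary.no _ = ν y

_⊨ᵗ_at_under_ : ∀ {n} → DataWord n → TPTL n → ℕ → Valuation → Set
w ⊨ᵗ prop p at i under ν = p ∈ props w i
w ⊨ᵗ (x ∈ᵗ I) at i under ν = diff (datum w i) (ν x) ∈I I
w ⊨ᵗ (¬ᵗ φ) at i under ν = ¬ (w ⊨ᵗ φ at i under ν)
w ⊨ᵗ (φ ∧ᵗ ψ) at i under ν = (w ⊨ᵗ φ at i under ν) × (w ⊨ᵗ ψ at i under ν)
w ⊨ᵗ (φ Uᵗ ψ) at i under ν =
  Σ ℕ λ j → (j > i) × (w ⊨ᵗ ψ at j under ν)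
          × (∀ k → i < k → k < j → w ⊨ᵗ φ at k under ν)
w ⊨ᵗ bind x φ at i under ν = w ⊨ᵗ φ at i under update ν x (datum w i)

_⊨ᵗ_ : ∀ {n} → DataWord n → TPTL n → Set
w ⊨ᵗ φ = w ⊨ᵗ φ at 0 under (λ _ → datum w 0)

InTPTL= : ∀ {n} → TPTL n → Set
InTPTL= (prop p) = ⊤
InTPTL= (x ∈ᵗ I) = I ≡ [ + 0 , + 0 ]
InTPTL= (¬ᵗ φ) = InTPTL= φ
InTPTL= (φ ∧ᵗ ψ) = InTPTL= φ × InTPTL= ψ
InTPTL= (φ Uᵗ ψ) = InTPTL= φ × InTPTL= ψ
InTPTL= (bind x φ) = InTPTL= φ

Equivalent : ∀ {n} → MTL n → TPTL n → Set
Equivalent φ ψ = ∀ w → (w ⊨ᵐ φ) ⇔ (w ⊨ᵗ ψ)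

-- A TPTL_= formula only ever compares a datum with a stored datum for
-- equality, so its truth is unchanged when all data are renamed by an
-- injective map, e.g. doubled. But doubling the data of the word
-- (∅,0)(∅,1)(∅,1)… turns a satisfying word of F_[1,1] true into one
-- with only even data differences, which fails it.

module Submission where

open import Defs
open import Data.Nat using (ℕ; zero; suc; _*_; _≟_; z≤n; s≤s)
open import Data.Nat.Properties using (*-cancelˡ-≡)
open import Data.Integer using (+_; +≤+)
open import Data.Integer.Properties
  using (+-injective; i-j≡0⇒i≡j; i≡j⇒i-j≡0; ≤-antisym; ≤-refl; ≤-reflexive)
open import Data.Fin using (Fin)
open import Data.Fin.Subset using (⊥)
open import Data.Product using (Σ; _×_; _,_)
open import Data.Product.Function.NonDependent.Propositional using (_×-⇔_)
import Data.Product.Function.Dependent.Propositional as Σ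
open import Function using (_∘_)
open import Function.Bundles using (_⇔_; mk⇔; Equivalence)
open import Function.Definitions using (Injective)
open import Function.Related.TypeIsomorphisms using (¬-cong-⇔; →-cong-⇔)
open import Function.Construct.Identity using (⇔-id)
open import Relation.Nullary using (¬_; yes; no)
open import Relation.Binary.PropositionalEquality
  using (_≡_; refl; sym; trans; cong)

open Equivalence using (to; from)

∀-cong-⇔ : {X : Set} {A B : X → Set} →
  (∀ x → A x ⇔ B x) → ((x : X) → A x) ⇔ ((x : X) → B x)
∀-cong-⇔ A⇔B = mk⇔ (λ f x → to (A⇔B x) (f x)) (λ g x → from (A⇔B x) (g x))

diff∈[0,0]⇔≡ : ∀ {a b} → diff a b ∈I [ + 0 , + 0 ] ⇔ a ≡ b
diff∈[0,0]⇔≡ {a} {b} = mk⇔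
  (λ (l , h) → +-injective (i-j≡0⇒i≡j (+ a) (+ b) (≤-antisym h l)))
  (λ a≡b → let a-b≡0 = i≡j⇒i-j≡0 (cong +_ a≡b) in
    ≤-reflexive (sym a-b≡0) , ≤-reflexive a-b≡0)

mapDatum : ∀ {n} → (ℕ → ℕ) → DataWord n → DataWord n
mapDatum f w = record { props = props w ; datum = f ∘ datum w }

module _ {f : ℕ → ℕ} (f-injective : Injective _≡_ _≡_ f) where

  Tracks : Valuation → Valuation → Set
  Tracks ν ν′ = ∀ x → ν′ x ≡ f (ν x)

  update-tracks : ∀ {ν ν′} x d → Tracks ν ν′ →
    Tracks (update ν x d) (update ν′ x (f d))
  update-tracks x d tracks y with y ≟ x
  ... | yes _ = refl
  ... | no  _ = tracks y

  ⊨ᵗ=-mapDatum-at : ∀ {n} (ψ : TPTL n) → InTPTL= ψ → ∀ w i {ν ν′} →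
    Tracks ν ν′ →
    (w ⊨ᵗ ψ at i under ν) ⇔ (mapDatum f w ⊨ᵗ ψ at i under ν′)
  ⊨ᵗ=-mapDatum-at (prop p) _ w i _ = ⇔-id _
  ⊨ᵗ=-mapDatum-at (x ∈ᵗ _) refl w i tracks = mk⇔
    (λ h → from diff∈[0,0]⇔≡ (trans (cong f (to diff∈[0,0]⇔≡ h)) (sym (tracks x))))
    (λ h → from diff∈[0,0]⇔≡ (f-injective (trans (to diff∈[0,0]⇔≡ h) (tracks x))))
  ⊨ᵗ=-mapDatum-at (¬ᵗ ψ) h w i tracks =
    ¬-cong-⇔ (⊨ᵗ=-mapDatum-at ψ h w i tracks)
  ⊨ᵗ=-mapDatum-at (ψ ∧ᵗ φ) (hψ , hφ) w i tracks =
    ⊨ᵗ=-mapDatum-at ψ hψ w i tracks ×-⇔ ⊨ᵗ=-mapDatum-at φ hφ w i tracks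
  ⊨ᵗ=-mapDatum-at (ψ Uᵗ φ) (hψ , hφ) w i tracks = Σ.congˡ λ {j} →
    ⇔-id _ ×-⇔ (⊨ᵗ=-mapDatum-at φ hφ w j tracks ×-⇔ ∀-cong-⇔ λ k →
      →-cong-⇔ (⇔-id _) (→-cong-⇔ (⇔-id _) (⊨ᵗ=-mapDatum-at ψ hψ w k tracks)))
  ⊨ᵗ=-mapDatum-at (bind x ψ) h w i tracks =
    ⊨ᵗ=-mapDatum-at ψ h w i (update-tracks x (datum w i) tracks)

  ⊨ᵗ=-mapDatum : ∀ {n} (ψ : TPTL n) → InTPTL= ψ → ∀ w →
    (w ⊨ᵗ ψ) ⇔ (mapDatum f w ⊨ᵗ ψ)
  ⊨ᵗ=-mapDatum ψ h w = ⊨ᵗ=-mapDatum-at ψ h w 0 (λ _ → refl)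

unitStep : ∀ {n} → DataWord n
unitStep = record { props = λ _ → ⊥ ; datum = λ { zero → 0 ; (suc _) → 1 } }

trueᵐ-holds : ∀ {n} (p : Fin n) (w : DataWord n) i → w ⊨ᵐ trueᵐ p at i
trueᵐ-holds p w i (p∉ , ¬p∉) = ¬p∉ p∉

unitStep⊨F11true : ∀ {n} (p : Fin n) → unitStep ⊨ᵐ F11true p
unitStep⊨F11true p =
  1 , s≤s z≤n , trueᵐ-holds p unitStep 1 , (≤-refl , ≤-refl) ,
  λ { k (s≤s z≤n) (s≤s ()) }

doubled-unitStep⊭F11true : ∀ {n} (p : Fin n) →
  ¬ (mapDatum (2 *_) unitStep ⊨ᵐ F11true p)
doubled-unitStep⊭F11true p (suc _ , _ , _ , (_ , +≤+ (s≤s ())) , _)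

proposition6 : (n : ℕ) (p : Fin n) →
    ¬ (Σ (TPTL n) λ ψ → InTPTL= ψ × Equivalent (F11true p) ψ)
proposition6 n p (ψ , ψ∈TPTL= , F11true≡ψ) =
  doubled-unitStep⊭F11true p
    (from (F11true≡ψ (mapDatum (2 *_) unitStep))
      (to (⊨ᵗ=-mapDatum doubling-injective ψ ψ∈TPTL= unitStep)
        (to (F11true≡ψ unitStep) (unitStep⊨F11true p))))
  where
  doubling-injective : Injective _≡_ _≡_ (2 *_)
  doubling-injective = *-cancelˡ-≡ _ _ 2
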